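{- Let $G=(V,E)$ be a directed graph with positive edge weights, let $\emptyset\ne S\subsetneq V$ be the source side of a global minimum cut of $G$, and let $T$ be an $s$-arborescence of $G$ rooted at $s\in S$ with exactly one edge of $T$ going from $S$ to $\overline{S}=V\setminus S$. Define $C_0=\{s\}$ and let $P_1$ be the set of subtrees (connected components, ignoring edge directions) of $T$ after removing $s$. For $i\ge1$, let $C_i$ consist of one chosen centroid of each subtree $U\in P_i$, and let $P_{i+1}$ be the set of all subtrees obtained by removing the chosen centroid $u$ from $U$, over all $U\in P_i$. If $i\ge 1$ and $C_j\subseteq S$ for every $0\le j<i$, then $\overline{S}$ is contained in exactly one subtree in $P_i$, and consequently at most one vertex of $C_i$ lies in $\overline{S}$.
   Context: An $s$-arborescence is a directed spanning tree rooted at $s$ with all edges directed away from $s$. A centroid of a tree $U$ (viewed as undirected) is a vertex whose removal leaves connected components each having at most $|U|/2$ vertices. A global minimum cut is a set $\emptyset\ne S\subsetneq V$ minimizing the total weight of edges from $S$ to $V\setminus S$.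
   Formalization: The edge weights of G are positive rationals. -}

module Defs where

open import Data.Nat using (ℕ; zero; suc; _*_) renaming (_≤_ to _≤ℕ_)
open import Data.Fin using (Fin; zero; suc)
open import Data.Fin.Subset using (Subset; _∈_; _∉_; _⊆_; _-_; ∁; ∣_∣; Nonempty; ⊤)
open import Data.Vec using (lookup)
open import Data.Bool using (Bool; true; false; if_then_else_; _∧_; not)
open import Data.Rational using (ℚ; 0ℚ; _+_; _≤_; _<_)
open import Data.Product using (Σ; ∃; ∃!; _×_; _,_)
open import Data.Sum using (_⊎_)
open import Relation.Binary.PropositionalEquality using (_≡_; _≢_)
open import Relation.Binary.Construct.Closure.ReflexiveTransitive using (Star)

-- Weighted directed graphs on vertex set V = Fin n.
-- A graph is given by a nonnegative weight function w; the edges are the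
-- pairs (u , v) with 0 < w u v (so every edge has positive weight).

IsWeightedDigraph : (n : ℕ) → (Fin n → Fin n → ℚ) → Set
IsWeightedDigraph n w = ∀ u v → 0ℚ ≤ w u v

Edge : {n : ℕ} → (Fin n → Fin n → ℚ) → Fin n → Fin n → Set
Edge w u v = 0ℚ < w u v

sumFin : (n : ℕ) → (Fin n → ℚ) → ℚ
sumFin zero    f = 0ℚ
sumFin (suc n) f = f zero + sumFin n (λ i → f (suc i))

cutWeight : {n : ℕ} → (Fin n → Fin n → ℚ) → Subset n → ℚ
cutWeight {n} w S =
  sumFin n (λ u → sumFin n (λ v →
    if lookup S u ∧ not (lookup S v) then w u v else 0ℚ))

ProperNonempty : {n : ℕ} → Subset n → Set
ProperNonempty S = Nonempty S × Nonempty (∁ S)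

IsGlobalMinCut : {n : ℕ} → (Fin n → Fin n → ℚ) → Subset n → Set
IsGlobalMinCut {n} w S =
  ProperNonempty S × (∀ (S' : Subset n) → ProperNonempty S' → cutWeight w S ≤ cutWeight w S')

IsArborescence : {n : ℕ} → (Fin n → Fin n → ℚ) → Fin n → (Fin n → Fin n → Set) → Set
IsArborescence {n} w s T =
  (∀ u v → T u v → Edge w u v) ×
  (∀ u → ¬T u s) ×
  (∀ v → v ≢ s → ∃! _≡_ (λ u → T u v)) ×
  (∀ v → Star T s v)
  where
    ¬T : Fin n → Fin n → Set
    ¬T u v = T u v → Data.Empty.⊥
      where import Data.Empty

Adj : {n : ℕ} → (Fin n → Fin n → Set) → Fin n → Fin n → Set
Adj T u v = T u v ⊎ T v u

AdjIn : {n : ℕ} → (Fin n → Fin n → Set) → Subset n → Fin n → Fin n → Set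
AdjIn T K u v = Adj T u v × u ∈ K × v ∈ K

ConnectedIn : {n : ℕ} → (Fin n → Fin n → Set) → Subset n → Set
ConnectedIn T K = ∀ u v → u ∈ K → v ∈ K → Star (AdjIn T K) u v

IsComponent : {n : ℕ} → (Fin n → Fin n → Set) → Subset n → Subset n → Set
IsComponent T X K =
  K ⊆ X × Nonempty K × ConnectedIn T K ×
  (∀ u v → u ∈ K → v ∈ X → Adj T u v → v ∈ K)

IsCentroid : {n : ℕ} → (Fin n → Fin n → Set) → Subset n → Fin n → Set
IsCentroid T U u =
  u ∈ U × (∀ K → IsComponent T (U - u) K → 2 * ∣ K ∣ ≤ℕ ∣ U ∣)

-- The centroid decomposition process, driven by a choice function
-- ch i U (the centroid chosen for the subtree U ∈ P_i).

-- P T s ch i U  :  U ∈ P_i   (P_0 is empty; it is never used)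
P : {n : ℕ} → (Fin n → Fin n → Set) → Fin n → (ℕ → Subset n → Fin n) → ℕ → Subset n → Set
P T s ch zero          U = Data.Empty.⊥ where import Data.Empty
P T s ch (suc zero)    U = IsComponent T (⊤ - s) U
P T s ch (suc (suc i)) K = Σ _ (λ U → P T s ch (suc i) U × IsComponent T (U - ch (suc i) U) K)

C : {n : ℕ} → (Fin n → Fin n → Set) → Fin n → (ℕ → Subset n → Fin n) → ℕ → Fin n → Set
C T s ch zero    v = v ≡ s
C T s ch (suc i) v = Σ _ (λ U → P T s ch (suc i) U × ch (suc i) U ≡ v)

ValidChoice : {n : ℕ} → (Fin n → Fin n → Set) → Fin n → (ℕ → Subset n → Fin n) → Set
ValidChoice T s ch = ∀ i U → P T s ch (suc i) U → IsCentroid T U (ch (suc i) U)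

-- Since exactly one tree edge (a , b) leaves S, every vertex of S̄ reaches b by
-- climbing tree edges without leaving S̄, so S̄ is connected in T.  Removing
-- vertices of S therefore never separates S̄: by induction on i, S̄ lies in a
-- subtree of P_i, namely the component containing b.  The subtrees of P_i are
-- pairwise disjoint, so this subtree is unique, and a vertex of C_i outside S
-- must be the centroid chosen for it.
module Submission where

open import Defs
open import Data.Nat using (ℕ; zero; suc; _<_)
open import Data.Nat.Properties using (≤-refl; m≤n⇒m≤1+n)
open import Data.Fin using (Fin; _≟_)
open import Data.Fin.Subset using (Subset; _∈_; _∉_; _⊆_; ∁; ⊤; _-_)
open import Data.Fin.Subset.Properties
  using (_∈?_; ⊆-antisym; x∈∁p⇒x∉p; x∉p⇒x∈∁p; x∈p∧x≢y⇒x∈p-y; p─q⊆p; ∈⊤)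
open import Data.Vec using (tabulate)
open import Data.Vec.Properties using (lookup∘tabulate; lookup⇒[]=; []=⇒lookup)
open import Data.Bool.Properties using (T-≡)
open import Data.Product using (Σ; ∃!; _×_; _,_; proj₁; proj₂)
open import Data.Sum using (inj₁; inj₂)
open import Data.Empty using (⊥; ⊥-elim)
open import Data.Rational using (ℚ)
open import Function using (Equivalence; flip; id)
open import Level using (Level)
open import Relation.Nullary.Decidable using (isYes; yes; no; toWitness; fromWitness; _×-dec_)
open import Relation.Unary using (Pred; Decidable)
open import Relation.Binary.PropositionalEquality using (_≡_; refl; sym; trans; cong; subst)
open import Relation.Binary.Construct.Closure.ReflexiveTransitive
  using (Star; ε; _◅_; _◅◅_; reverse; map)

module _ {n : ℕ} {ℓ : Level} {P : Pred (Fin n) ℓ} (P? : Decidable P) where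

  subsetOf : Subset n
  subsetOf = tabulate (λ x → isYes (P? x))

  ∈-subsetOf⁺ : ∀ {x} → P x → x ∈ subsetOf
  ∈-subsetOf⁺ {x} px =
    lookup⇒[]= x subsetOf (trans (lookup∘tabulate _ x) (Equivalence.to T-≡ (fromWitness px)))

  ∈-subsetOf⁻ : ∀ {x} → x ∈ subsetOf → P x
  ∈-subsetOf⁻ {x} x∈ =
    toWitness (Equivalence.from T-≡ (trans (sym (lookup∘tabulate _ x)) ([]=⇒lookup x∈)))

module Components {n : ℕ} (T : Fin n → Fin n → Set) where

  ClosedIn : Subset n → Subset n → Set
  ClosedIn X K = ∀ u v → u ∈ K → v ∈ X → Adj T u v → v ∈ K

  AdjIn-sym : ∀ {K u v} → AdjIn T K u v → AdjIn T K v u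
  AdjIn-sym (inj₁ t , u∈K , v∈K) = inj₂ t , v∈K , u∈K
  AdjIn-sym (inj₂ t , u∈K , v∈K) = inj₁ t , v∈K , u∈K

  AdjIn-mono : ∀ {K X u v} → K ⊆ X → AdjIn T K u v → AdjIn T X u v
  AdjIn-mono K⊆X (a , u∈K , v∈K) = a , K⊆X u∈K , K⊆X v∈K

  walk-restrict : ∀ {X K u v} → ClosedIn X K → u ∈ K → Star (AdjIn T X) u v → Star (AdjIn T K) u v
  walk-restrict closed u∈K ε = ε
  walk-restrict closed u∈K ((a , _ , v∈X) ◅ walk) =
    (a , u∈K , v∈K) ◅ walk-restrict closed v∈K walk
    where v∈K = closed _ _ u∈K v∈X a

  walk-target∈ : ∀ {K u v} → u ∈ K → Star (AdjIn T K) u v → v ∈ K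
  walk-target∈ u∈K ε = u∈K
  walk-target∈ _ ((_ , _ , v∈K) ◅ walk) = walk-target∈ v∈K walk

  walk-stays-in-component : ∀ {X K u v} → IsComponent T X K →
                            u ∈ K → Star (AdjIn T X) u v → v ∈ K
  walk-stays-in-component (_ , _ , _ , closed) u∈K walk =
    walk-target∈ u∈K (walk-restrict closed u∈K walk)

  component-⊆ : ∀ {X K K' x} → IsComponent T X K → IsComponent T X K' →
                x ∈ K → x ∈ K' → K ⊆ K'
  component-⊆ (K⊆X , _ , connected , _) cK' x∈K x∈K' y∈K =
    walk-stays-in-component cK' x∈K' (map (AdjIn-mono K⊆X) (connected _ _ x∈K y∈K))

  component-unique : ∀ {X K K' x} → IsComponent T X K → IsComponent T X K' →
                     x ∈ K → x ∈ K' → K ≡ K'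
  component-unique cK cK' x∈K x∈K' =
    ⊆-antisym (component-⊆ cK cK' x∈K x∈K') (component-⊆ cK' cK x∈K' x∈K)

module Arborescence {n : ℕ} {w : Fin n → Fin n → ℚ} {s : Fin n} {T : Fin n → Fin n → Set}
                    (arb : IsArborescence w s T) where

  open Components T

  no-edge-into-root : ∀ {u} → T u s → ⊥
  no-edge-into-root = proj₁ (proj₂ arb) _

  parent-unique : ∀ {u u' v} → T u v → T u' v → u ≡ u'
  parent-unique {v = v} t t' with v ≟ s
  ... | yes refl = ⊥-elim (no-edge-into-root t)
  ... | no v≢s   = trans (sym (uniqueness t)) (uniqueness t')
    where uniqueness = proj₂ (proj₂ (proj₁ (proj₂ (proj₂ arb)) v v≢s))

  RootPath : Fin n → Set
  RootPath v = Star (flip T) v s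

  rootPath : ∀ v → RootPath v
  rootPath v = reverse id (proj₂ (proj₂ (proj₂ arb)) v)

  -- The components of the forest induced by X are the classes of vertices of X
  -- with the same topmost ancestor that can be reached inside X.
  module Forest (X : Subset n) where

    topmost : ∀ {v} → RootPath v → Fin n
    topmost {v} ε = v
    topmost {v} (_◅_ {j = u} _ p) with u ∈? X
    ... | yes _ = topmost p
    ... | no _  = v

    topmost-irrelevant : ∀ {v} (p q : RootPath v) → topmost p ≡ topmost q
    topmost-irrelevant ε ε = refl
    topmost-irrelevant ε (t ◅ _) = ⊥-elim (no-edge-into-root t)
    topmost-irrelevant (t ◅ _) ε = ⊥-elim (no-edge-into-root t)
    topmost-irrelevant (_◅_ {j = u} t p) (t' ◅ q) with parent-unique t t'
    ... | refl with u ∈? X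
    ... | yes _ = topmost-irrelevant p q
    ... | no _  = refl

    top : Fin n → Fin n
    top v = topmost (rootPath v)

    top-of-edge : ∀ {u v} → T u v → u ∈ X → top v ≡ top u
    top-of-edge {u} {v} t u∈X =
      trans (topmost-irrelevant (rootPath v) (t ◅ rootPath u)) climb
      where
        climb : topmost (t ◅ rootPath u) ≡ top u
        climb with u ∈? X
        ... | yes _   = refl
        ... | no u∉X = ⊥-elim (u∉X u∈X)

    walk-to-topmost : ∀ {v} (p : RootPath v) → v ∈ X → Star (AdjIn T X) v (topmost p)
    walk-to-topmost ε _ = ε
    walk-to-topmost (_◅_ {j = u} t p) v∈X with u ∈? X
    ... | yes u∈X = (inj₂ t , v∈X , u∈X) ◅ walk-to-topmost p u∈X
    ... | no _    = ε

    componentOf : Fin n → Subset n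
    componentOf v = subsetOf (λ x → x ∈? X ×-dec top x ≟ top v)

    componentOf-closed : ∀ v → ClosedIn X (componentOf v)
    componentOf-closed v x y x∈K y∈X adj with ∈-subsetOf⁻ _ x∈K
    ... | x∈X , tx≡tv = ∈-subsetOf⁺ _ (y∈X , trans (same-top adj) tx≡tv)
      where
        same-top : Adj T x y → top y ≡ top x
        same-top (inj₁ t) = top-of-edge t x∈X
        same-top (inj₂ t) = sym (top-of-edge t y∈X)

    componentOf-connected : ∀ v → ConnectedIn T (componentOf v)
    componentOf-connected v x y x∈K y∈K
      with ∈-subsetOf⁻ _ x∈K | ∈-subsetOf⁻ _ y∈K
    ... | x∈X , tx≡tv | y∈X , ty≡tv =
      walk-restrict (componentOf-closed v) x∈K
        (subst (Star (AdjIn T X) x) (trans tx≡tv (sym ty≡tv)) (walk-to-topmost (rootPath x) x∈X)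
         ◅◅ reverse AdjIn-sym (walk-to-topmost (rootPath y) y∈X))

    componentOf-isComponent : ∀ {v} → v ∈ X → IsComponent T X (componentOf v)
    componentOf-isComponent {v} v∈X =
      (λ x∈K → proj₁ (∈-subsetOf⁻ _ x∈K)) ,
      (v , ∈-subsetOf⁺ _ (v∈X , refl)) ,
      componentOf-connected v ,
      componentOf-closed v

module UniqueCrossingEdge {n : ℕ} {w : Fin n → Fin n → ℚ} {s : Fin n} {T : Fin n → Fin n → Set}
    (arb : IsArborescence w s T) (S : Subset n) (s∈S : s ∈ S)
    (crossing : ∃! _≡_ (λ (e : Fin n × Fin n) → T (proj₁ e) (proj₂ e) × proj₁ e ∈ S × proj₂ e ∉ S))
  where

  open Components T
  open Arborescence arb

  b : Fin n
  b = proj₂ (proj₁ crossing)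

  b∈∁S : b ∈ ∁ S
  b∈∁S = x∉p⇒x∈∁p (proj₂ (proj₂ (proj₁ (proj₂ crossing))))

  climb-to-crossing : ∀ {x} → RootPath x → x ∉ S → Star (AdjIn T (∁ S)) x b
  climb-to-crossing ε x∉S = ⊥-elim (x∉S s∈S)
  climb-to-crossing {x} (_◅_ {j = u} t p) x∉S with u ∈? S
  ... | yes u∈S = subst (Star _ x) (sym (cong proj₂ (proj₂ (proj₂ crossing) (t , u∈S , x∉S)))) ε
  ... | no u∉S  = (inj₂ t , x∉p⇒x∈∁p x∉S , x∉p⇒x∈∁p u∉S) ◅ climb-to-crossing p u∉S

  component-containing-complement : ∀ {X} → ∁ S ⊆ X → Σ (Subset n) λ K → IsComponent T X K × ∁ S ⊆ K
  component-containing-complement {X} ∁S⊆X =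
    componentOf b , cK , λ x∈∁S →
      walk-stays-in-component cK b∈K
        (reverse AdjIn-sym (map (AdjIn-mono ∁S⊆X) (climb-to-crossing (rootPath _) (x∈∁p⇒x∉p x∈∁S))))
    where
      open Forest X
      cK = componentOf-isComponent (∁S⊆X b∈∁S)
      b∈K = ∈-subsetOf⁺ _ (∁S⊆X b∈∁S , refl)

  ∁⊆-remove : ∀ {X y} → ∁ S ⊆ X → y ∈ S → ∁ S ⊆ X - y
  ∁⊆-remove ∁S⊆X y∈S x∈∁S = x∈p∧x≢y⇒x∈p-y (∁S⊆X x∈∁S) λ { refl → x∈∁p⇒x∉p x∈∁S y∈S }

  subtree-containing-complement :
    (ch : ℕ → Subset n → Fin n) → ∀ i →
    (∀ j → j < suc i → ∀ v → C T s ch j v → v ∈ S) →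
    Σ (Subset n) λ U → P T s ch (suc i) U × ∁ S ⊆ U
  subtree-containing-complement ch zero _ =
    component-containing-complement (∁⊆-remove (λ _ → ∈⊤) s∈S)
  subtree-containing-complement ch (suc i) C⊆S
    with subtree-containing-complement ch i (λ j j<i → C⊆S j (m≤n⇒m≤1+n j<i))
  ... | U , U∈P , ∁S⊆U
    with component-containing-complement (∁⊆-remove ∁S⊆U (C⊆S (suc i) ≤-refl _ (U , U∈P , refl)))
  ... | K , cK , ∁S⊆K = K , (U , U∈P , cK) , ∁S⊆K

module CentroidDecomposition {n : ℕ} (T : Fin n → Fin n → Set) (s : Fin n)
                             (ch : ℕ → Subset n → Fin n) where

  open Components T

  subtrees-disjoint : ∀ i {U U' x} → P T s ch (suc i) U → P T s ch (suc i) U' →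
                      x ∈ U → x ∈ U' → U ≡ U'
  subtrees-disjoint zero cU cU' x∈U x∈U' = component-unique cU cU' x∈U x∈U'
  subtrees-disjoint (suc i) (V , V∈P , cU) (V' , V'∈P , cU') x∈U x∈U'
    with subtrees-disjoint i V∈P V'∈P (p─q⊆p _ _ (proj₁ cU x∈U)) (p─q⊆p _ _ (proj₁ cU' x∈U'))
  ... | refl = component-unique cU cU' x∈U x∈U'

  chosen-in-own-subtree : ValidChoice T s ch → ∀ i {U u} →
                          C T s ch (suc i) u → P T s ch (suc i) U → u ∈ U → u ≡ ch (suc i) U
  chosen-in-own-subtree valid i (V , V∈P , refl) U∈P u∈U =
    cong (ch (suc i)) (subtrees-disjoint i V∈P U∈P (proj₁ (valid i V V∈P)) u∈U)

lemma13 : (n : ℕ) (w : Fin n → Fin n → ℚ) (S : Subset n) (s : Fin n)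
    (T : Fin n → Fin n → Set) (ch : ℕ → Subset n → Fin n) →
    IsWeightedDigraph n w →
    IsGlobalMinCut w S →
    s ∈ S →
    IsArborescence w s T →
    ∃! _≡_ (λ (e : Fin n × Fin n) → T (proj₁ e) (proj₂ e) × proj₁ e ∈ S × proj₂ e ∉ S) →
    ValidChoice T s ch →
    (i : ℕ) →
    (∀ j → j < suc i → ∀ v → C T s ch j v → v ∈ S) →
    ∃! _≡_ (λ U → P T s ch (suc i) U × ∁ S ⊆ U) ×
    (∀ u v → C T s ch (suc i) u → C T s ch (suc i) v → u ∉ S → v ∉ S → u ≡ v)
lemma13 n w S s T ch _ _ s∈S arb crossing valid i C⊆S
  with UniqueCrossingEdge.subtree-containing-complement arb S s∈S crossing ch i C⊆S
... | U , U∈P , ∁S⊆U =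
  (U , (U∈P , ∁S⊆U) , λ (U'∈P , ∁S⊆U') → subtrees-disjoint i U∈P U'∈P (∁S⊆U b∈∁S) (∁S⊆U' b∈∁S)) ,
  λ u v u∈C v∈C u∉S v∉S →
    trans (chosen-in-own-subtree valid i u∈C U∈P (∁S⊆U (x∉p⇒x∈∁p u∉S)))
          (sym (chosen-in-own-subtree valid i v∈C U∈P (∁S⊆U (x∉p⇒x∈∁p v∉S))))
  where
    open CentroidDecomposition T s ch
    open UniqueCrossingEdge arb S s∈S crossing using (b∈∁S)
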